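{- For every integer $n\ge 1$, $\chi_{la}(nC_4(8,2))=3$.
   Context: For a graph $G=(V,E)$ with $|E|=m$ and no isolated vertices, a local antimagic labeling is a bijection $f:E\to\{1,\dots,m\}$ such that $f^+(u)\ne f^+(v)$ for every edge $uv$, where $f^+(x)=\sum f(e)$ over all edges $e$ incident to $x$. The local antimagic chromatic number $\chi_{la}(G)$ is the minimum, over all local antimagic labelings $f$ of $G$, of the number of distinct values taken by $f^+$ (also for disconnected graphs). $nG$ is the disjoint union of $n$ copies of $G$. $C_4(8,2)$ is the graph with vertex set $\{u_i,v_i:1\le i\le 8\}$ and edges $u_iu_{i+1}$, $v_iv_{i+1}$ ($1\le i\le 8$, indices mod 8) and $u_{2j}v_{2j}$ ($1\le j\le 4$); i.e., the prism $C_8\times P_2$ with the four rungs $u_{2j-1}v_{2j-1}$ deleted. -}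

module Defs where

open import Data.Nat using (ℕ; zero; suc; _+_; _*_; _≤_)
open import Data.Nat.Properties using (_≟_)
open import Data.Fin as Fin using (Fin; toℕ; #_; remQuot; combine)
import Data.Fin.Properties as FinP
open import Data.Bool using (Bool; true; false; if_then_else_; _∨_)
open import Data.Product using (_×_; _,_; proj₁; proj₂; Σ; ∃)
open import Data.List using (List; tabulate; length; deduplicate)
open import Data.Nat.ListAction using (sum)
open import Data.Vec using (Vec; []; _∷_; lookup)
open import Relation.Nullary using (does; ¬_)
open import Relation.Binary.PropositionalEquality using (_≡_)
open import Function.Bundles using (_↔_; Inverse)

record Graph : Set where
  field
    nv   : ℕ
    ne   : ℕ
    ends : Fin ne → Fin nv × Fin nv
open Graph public

-- Edge labelings: bijections E → {1,…,m}, encoded as permutations of Fin m;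
-- edge e receives label 1 + toℕ (to f e).
Labeling : Graph → Set
Labeling G = Fin (ne G) ↔ Fin (ne G)

label : (G : Graph) → Labeling G → Fin (ne G) → ℕ
label G f e = suc (toℕ (Inverse.to f e))

incident : (G : Graph) → Fin (nv G) → Fin (ne G) → Bool
incident G x e = does (x FinP.≟ proj₁ (ends G e)) ∨ does (x FinP.≟ proj₂ (ends G e))

vsum : (G : Graph) → Labeling G → Fin (nv G) → ℕ
vsum G f x = sum (tabulate {n = ne G} (λ e → if incident G x e then label G f e else 0))

IsLocalAntimagic : (G : Graph) → Labeling G → Set
IsLocalAntimagic G f = ∀ e → ¬ (vsum G f (proj₁ (ends G e)) ≡ vsum G f (proj₂ (ends G e)))

numColors : (G : Graph) → Labeling G → ℕ
numColors G f = length (deduplicate _≟_ (tabulate {n = nv G} (vsum G f)))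

ChiLa≡ : Graph → ℕ → Set
ChiLa≡ G k =
  (Σ (Labeling G) λ f → IsLocalAntimagic G f × numColors G f ≡ k)
  × (∀ (f : Labeling G) → IsLocalAntimagic G f → k ≤ numColors G f)

copies : ℕ → Graph → Graph
copies n G = record
  { nv = n * nv G
  ; ne = n * ne G
  ; ends = λ e → let ce = remQuot {n} (ne G) e
                     ab = ends G (proj₂ ce)
                 in combine (proj₁ ce) (proj₁ ab) , combine (proj₁ ce) (proj₂ ab)
  }

-- C₄(8,2): u_i ↦ i-1 (0..7), v_i ↦ 7+i (8..15), i = 1..8.
-- edges: u_i u_{i+1} (8), v_i v_{i+1} (8), rungs u_{2j} v_{2j}, j=1..4.
C4-8-2-edges : Vec (Fin 16 × Fin 16) 20
C4-8-2-edges =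
    (# 0 , # 1) ∷ (# 1 , # 2) ∷ (# 2 , # 3) ∷ (# 3 , # 4)
  ∷ (# 4 , # 5) ∷ (# 5 , # 6) ∷ (# 6 , # 7) ∷ (# 7 , # 0)
  ∷ (# 8 , # 9) ∷ (# 9 , # 10) ∷ (# 10 , # 11) ∷ (# 11 , # 12)
  ∷ (# 12 , # 13) ∷ (# 13 , # 14) ∷ (# 14 , # 15) ∷ (# 15 , # 8)
  ∷ (# 1 , # 9) ∷ (# 3 , # 11) ∷ (# 5 , # 13) ∷ (# 7 , # 15)
  ∷ []

C4-8-2 : Graph
C4-8-2 = record { nv = 16 ; ne = 20 ; ends = lookup C4-8-2-edges }

{-# OPTIONS --safe #-}
module Submission where

-- Lower bound: suppose some local antimagic labelling of n C₄(8,2) takes only two vertex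
-- sums p ≠ q.  Adjacent vertices get different sums, so inside one copy the sums alternate
-- along the edges and follow the bipartition of C₄(8,2), whose two classes have eight
-- vertices each.  Every edge has one end in each class, so both 8p and 8q equal the sum of
-- the labels of that copy, which is absurd.
--
-- Upper bound: cut the labels 1, …, 20n into ten superblocks of 2n consecutive labels and
-- give each superblock to two edges of C₄(8,2), shared among the n copies either
-- alternately or in two consecutive halves, in the order of the copies or in the reverse
-- order.  The label of an edge in copy c is then an affine function of t = c and
-- o = n − 1 − c, and at every vertex the coefficients of t and of o in the incident labels
-- add up to the same number.  So the vertex sums only depend on t + o = n − 1; they are
-- 20n + 1, 29n + 2 or 31n + 1, following a proper 3-colouring of C₄(8,2).

open import Defs
open import Data.Bool using (Bool; true; false; if_then_else_; _∨_; _∧_; not)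
open import Data.Bool.Properties using (¬-not; ∨-zeroʳ; ∧-distribˡ-∨; not-injective)
import Data.Bool.Properties as Bool
open import Data.Empty using (⊥)
open import Data.Fin using (Fin; zero; suc; #_; toℕ; combine; remQuot; opposite; _↑ˡ_; _↑ʳ_; punchIn)
open import Data.Fin.Properties as FinP
  using ( remQuot-combine; combine-remQuot; combine-injective; toℕ-combine; toℕ-cast; *↔×
        ; opposite-prop; toℕ<n; punchInᵢ≢i; injective⇒≤; all?; ∀-cons)
open import Data.Fin.Permutation as Perm using (Permutation; _⟨$⟩ʳ_)
open import Data.List using (List; []; _∷_; tabulate; length; deduplicate; allFin)
import Data.List as List
open import Data.List.Membership.Propositional using (_∈_)
open import Data.List.Membership.Propositional.Properties
  using (∈-lookup; ∈-tabulate⁺; ∈-tabulate⁻; ∈-deduplicate⁺; ∈-deduplicate⁻; ∈-map⁺; ∈-map⁻; ∈-allFin)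
open import Data.List.Relation.Binary.Subset.Propositional using (_⊆_)
import Data.List.Relation.Unary.All as All
open import Data.List.Relation.Unary.AllPairs using ([]; _∷_)
open import Data.List.Relation.Unary.Any using (index; here; there)
open import Data.List.Relation.Unary.Any.Properties using (lookup-index)
open import Data.List.Relation.Unary.Unique.Propositional using (Unique)
open import Data.List.Relation.Unary.Unique.Propositional.Properties using (map⁺; allFin⁺)
open import Data.Nat using (ℕ; zero; suc; _+_; _*_; _∸_; _≤_; _<_; _≥_; _≤?_)
import Data.Nat.ListAction as ListAction
open import Data.Nat.Properties
  using ( _≟_; _<?_; +-*-semiring; +-assoc; +-identityʳ; *-identityʳ; *-comm; *-distribˡ-+; *-cancelˡ-≡
        ; +-mono-≤-<; *-monoˡ-≤; m+[n∸m]≡n; suc-injective; <⇒≢; ≤⇒≯; ≰⇒>; ≤-antisym)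
open import Data.Nat.Tactic.RingSolver using (solve-∀)
open import Algebra.Properties.Semiring.Sum +-*-semiring
  using (sum; sum-syntax; ∑-comm; sum-cong-≗; sum-replicate-zero; sum-remove)
open import Data.List.Relation.Unary.Unique.DecPropositional.Properties _≟_ using (deduplicate-!)
open import Data.Product using (_×_; _,_; proj₁; proj₂; ∃)
open import Data.Product.Algebra using (×-comm; ×-assoc)
open import Data.Product.Function.NonDependent.Propositional using (_×-↔_)
import Data.Product.Function.Dependent.Propositional as Σ
open import Data.Product.Properties using (≡-dec)
open import Data.Sum as Sum using (_⊎_; inj₁; inj₂)
open import Data.Vec using (Vec; []; _∷_; lookup)
open import Data.Vec.Functional using (Vector)
open import Function using (id; _∘_; _↔_; Inverse; mk↔ₛ′; mk⇔; case_of_)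
open import Function.Construct.Composition using (_↔-∘_)
open import Function.Construct.Identity using (↔-id)
open import Function.Related.Propositional using (bijection; module EquationalReasoning)
open import Relation.Nullary using (does; yes; no; ¬?; contradiction; _×-dec_)
open import Relation.Nullary.Decidable using (dec-true; dec-false; does-⇔; from-yes)
open import Relation.Binary.Definitions using (DecidableEquality)
open import Relation.Binary.PropositionalEquality

sum-tabulate : ∀ {n} (f : Fin n → ℕ) → ListAction.sum (tabulate f) ≡ sum f
sum-tabulate {zero}  f = refl
sum-tabulate {suc n} f = cong (f zero +_) (sum-tabulate (f ∘ suc))

sum-zero : ∀ {n} (t : Vector ℕ n) → (∀ i → t i ≡ 0) → sum t ≡ 0
sum-zero {n} t t≗0 = trans (sum-cong-≗ t≗0) (sum-replicate-zero n)

sum-concentrated : ∀ {n} (t : Vector ℕ n) i → (∀ j → j ≢ i → t j ≡ 0) → sum t ≡ t i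
sum-concentrated {suc n} t i t≗0 = begin
  sum t                     ≡⟨ sum-remove {i = i} t ⟩
  t i + sum (t ∘ punchIn i) ≡⟨ cong (t i +_) (sum-zero _ (λ j → t≗0 _ (punchInᵢ≢i i j))) ⟩
  t i + 0                   ≡⟨ +-identityʳ (t i) ⟩
  t i                       ∎
  where open ≡-Reasoning

sum-δ : ∀ {n} (t : Vector ℕ n) i → ∑[ j < n ] (if does (i FinP.≟ j) then t j else 0) ≡ t i
sum-δ t i = trans (sum-concentrated _ i off-diagonal) (cong (if_then t i else 0) (dec-true (i FinP.≟ i) refl))
  where
  off-diagonal : ∀ j → j ≢ i → (if does (i FinP.≟ j) then t j else 0) ≡ 0
  off-diagonal j j≢i = cong (if_then t j else 0) (dec-false (i FinP.≟ j) (j≢i ∘ sym))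

sum-if : ∀ {n} b (t : Vector ℕ n) → (if b then sum t else 0) ≡ ∑[ i < n ] (if b then t i else 0)
sum-if     true  t = refl
sum-if {n} false t = sym (sum-zero {n} _ (λ _ → refl))

if-∧ : ∀ b x {v : ℕ} → (if b ∧ x then v else 0) ≡ (if b then (if x then v else 0) else 0)
if-∧ true  x = refl
if-∧ false x = refl

sum-↑ : ∀ m k (h : Fin (m + k) → ℕ) → sum h ≡ sum (h ∘ (_↑ˡ k)) + sum (h ∘ (m ↑ʳ_))
sum-↑ zero    k h = refl
sum-↑ (suc m) k h = trans (cong (h zero +_) (sum-↑ m k (h ∘ suc))) (sym (+-assoc (h zero) _ _))

sum-combine : ∀ m k (h : Fin (m * k) → ℕ) → sum h ≡ ∑[ c < m ] ∑[ e < k ] h (combine c e)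
sum-combine zero    k h = refl
sum-combine (suc m) k h =
  trans (sum-↑ k (m * k) h) (cong (sum (h ∘ (_↑ˡ (m * k))) +_) (sum-combine m k (h ∘ (k ↑ʳ_))))

-- Weighted vertex sums and double counting

wsum : (G : Graph) → (Fin (ne G) → ℕ) → Fin (nv G) → ℕ
wsum G w x = ∑[ e < ne G ] (if incident G x e then w e else 0)

vsum≡wsum : ∀ G f x → vsum G f x ≡ wsum G (label G f) x
vsum≡wsum G f x = sum-tabulate {ne G} _

wsum-cong : ∀ G {v w : Fin (ne G) → ℕ} → (∀ e → v e ≡ w e) → ∀ x → wsum G v x ≡ wsum G w x
wsum-cong G v≗w x = sum-cong-≗ (λ e → cong (if incident G x e then_else 0) (v≗w e))

module _ (G : Graph) (e : Fin (ne G)) where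

  private
    a b : Fin (nv G)
    a = proj₁ (ends G e)
    b = proj₂ (ends G e)

  incident-endpointˡ : incident G a e ≡ true
  incident-endpointˡ rewrite dec-true (a FinP.≟ a) refl = refl

  incident-endpointʳ : incident G b e ≡ true
  incident-endpointʳ rewrite dec-true (b FinP.≟ b) refl = ∨-zeroʳ _

  incident⇒endpoint : ∀ {x} → incident G x e ≡ true → x ≡ a ⊎ x ≡ b
  incident⇒endpoint {x} x∈e with x FinP.≟ a | x FinP.≟ b
  ... | yes x≡a | _       = inj₁ x≡a
  ... | no _    | yes x≡b = inj₂ x≡b
  ... | no _    | no _    with () ← x∈e

IsProperTwoColouring : (G : Graph) → (Fin (nv G) → Bool) → Set
IsProperTwoColouring G χ = ∀ e → χ (proj₁ (ends G e)) ≢ χ (proj₂ (ends G e))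

classSum : (G : Graph) → (Fin (ne G) → ℕ) → (Fin (nv G) → Bool) → ℕ
classSum G w χ = ∑[ x < nv G ] (if χ x then wsum G w x else 0)

module _ (G : Graph) {χ : Fin (nv G) → Bool} (proper : IsProperTwoColouring G χ) where

  private
    edgeInClass : Fin (ne G) → ℕ → Vector ℕ (nv G)
    edgeInClass e v x = if χ x then (if incident G x e then v else 0) else 0

    opposite-colours : ∀ e → χ (proj₂ (ends G e)) ≡ not (χ (proj₁ (ends G e)))
    opposite-colours e = ¬-not (proper e ∘ sym)

    counted-at : ∀ e v p → χ p ≡ true → incident G p e ≡ true →
                 (∀ x → x ≢ p → incident G x e ≡ true → χ x ≡ false) →
                 sum (edgeInClass e v) ≡ v
    counted-at e v p χp≡true p∈e others = trans (sum-concentrated _ p zero-elsewhere) at-p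
      where
      at-p : edgeInClass e v p ≡ v
      at-p rewrite χp≡true | p∈e = refl
      zero-elsewhere : ∀ x → x ≢ p → edgeInClass e v x ≡ 0
      zero-elsewhere x x≢p with χ x in χx | incident G x e in x∈e
      ... | false | _     = refl
      ... | true  | false = refl
      ... | true  | true  with () ← trans (sym χx) (others x x≢p x∈e)

    edge-counted-once : ∀ e v → sum (edgeInClass e v) ≡ v
    edge-counted-once e v with χ (proj₁ (ends G e)) in χa
    ... | true  = counted-at e v _ χa (incident-endpointˡ G e) λ x x≢a x∈e →
      case incident⇒endpoint G e {x} x∈e of λ where
        (inj₁ x≡a)  → contradiction x≡a x≢a
        (inj₂ refl) → trans (opposite-colours e) (cong not χa)
    ... | false = counted-at e v _ (trans (opposite-colours e) (cong not χa)) (incident-endpointʳ G e) λ x x≢b x∈e →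
      case incident⇒endpoint G e {x} x∈e of λ where
        (inj₁ refl) → χa
        (inj₂ x≡b)  → contradiction x≡b x≢b

  classSum≡total : ∀ w → classSum G w χ ≡ ∑[ e < ne G ] w e
  classSum≡total w = begin
    classSum G w χ
      ≡⟨ sum-cong-≗ (λ x → sum-if (χ x) (λ e → if incident G x e then w e else 0)) ⟩
    ∑[ x < nv G ] ∑[ e < ne G ] edgeInClass e (w e) x ≡⟨ ∑-comm (λ x e → edgeInClass e (w e) x) ⟩
    ∑[ e < ne G ] sum (edgeInClass e (w e))           ≡⟨ sum-cong-≗ (λ e → edge-counted-once e (w e)) ⟩
    ∑[ e < ne G ] w e                                 ∎
    where open ≡-Reasoning

∀-combine : ∀ {n k} {P : Fin (n * k) → Set} → (∀ c a → P (combine c a)) → ∀ x → P x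
∀-combine {n} {k} {P} h x =
  subst P (combine-remQuot {n} k x) (h (proj₁ (remQuot {n} k x)) (proj₂ (remQuot {n} k x)))

does-combine : ∀ {n k} (c c′ : Fin n) (a b : Fin k) →
               does (combine c a FinP.≟ combine c′ b) ≡ does (c FinP.≟ c′) ∧ does (a FinP.≟ b)
does-combine c c′ a b = does-⇔ (mk⇔ (combine-injective c a c′ b) (λ { (refl , refl) → refl }))
                               (combine c a FinP.≟ combine c′ b) (c FinP.≟ c′ ×-dec a FinP.≟ b)

module _ (n : ℕ) (G : Graph) where

  ends-copies : ∀ (c : Fin n) e →
                ends (copies n G) (combine c e) ≡ (combine c (proj₁ (ends G e)) , combine c (proj₂ (ends G e)))
  ends-copies c e =
    cong (λ (c′ , e′) → combine c′ (proj₁ (ends G e′)) , combine c′ (proj₂ (ends G e′))) (remQuot-combine c e)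

  incident-copies : ∀ (c : Fin n) a c′ e →
                    incident (copies n G) (combine c a) (combine c′ e) ≡ does (c FinP.≟ c′) ∧ incident G a e
  incident-copies c a c′ e = begin
    incident (copies n G) (combine c a) (combine c′ e)
      ≡⟨ cong (λ (p , q) → does (combine c a FinP.≟ p) ∨ does (combine c a FinP.≟ q)) (ends-copies c′ e) ⟩
    does (combine c a FinP.≟ combine c′ p) ∨ does (combine c a FinP.≟ combine c′ q)
      ≡⟨ cong₂ _∨_ (does-combine c c′ a p) (does-combine c c′ a q) ⟩
    (does (c FinP.≟ c′) ∧ does (a FinP.≟ p)) ∨ (does (c FinP.≟ c′) ∧ does (a FinP.≟ q))
      ≡⟨ ∧-distribˡ-∨ (does (c FinP.≟ c′)) _ _ ⟨
    does (c FinP.≟ c′) ∧ incident G a e ∎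
    where
    open ≡-Reasoning
    p q : Fin (nv G)
    p = proj₁ (ends G e)
    q = proj₂ (ends G e)

  vsum-copies : ∀ f (c : Fin n) a →
                vsum (copies n G) f (combine c a) ≡ wsum G (label (copies n G) f ∘ combine c) a
  vsum-copies f c a = begin
    vsum (copies n G) f (combine c a)
      ≡⟨ vsum≡wsum (copies n G) f (combine c a) ⟩
    ∑[ x < n * ne G ] (if incident (copies n G) (combine c a) x then L x else 0)
      ≡⟨ sum-combine n (ne G) _ ⟩
    ∑[ c′ < n ] ∑[ e < ne G ] (if incident (copies n G) (combine c a) (combine c′ e) then L (combine c′ e) else 0)
      ≡⟨ sum-cong-≗ (λ c′ → sum-cong-≗ (λ e →
           trans (cong (if_then L (combine c′ e) else 0) (incident-copies c a c′ e))
                 (if-∧ (does (c FinP.≟ c′)) _))) ⟩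
    ∑[ c′ < n ] ∑[ e < ne G ] (if does (c FinP.≟ c′) then (if incident G a e then L (combine c′ e) else 0) else 0)
      ≡⟨ sum-cong-≗ (λ c′ → sum-if (does (c FinP.≟ c′)) (λ e → if incident G a e then L (combine c′ e) else 0)) ⟨
    ∑[ c′ < n ] (if does (c FinP.≟ c′) then wsum G (L ∘ combine c′) a else 0)
      ≡⟨ sum-δ (λ c′ → wsum G (L ∘ combine c′) a) c ⟩
    wsum G (L ∘ combine c) a ∎
    where
    open ≡-Reasoning
    L : Fin (n * ne G) → ℕ
    L = label (copies n G) f

lookup-injective : ∀ {A : Set} {xs : List A} → Unique xs → ∀ {i j} → List.lookup xs i ≡ List.lookup xs j → i ≡ j
lookup-injective {xs = x ∷ xs} (x∉xs ∷ uniq) {zero}  {zero}  _  = refl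
lookup-injective {xs = x ∷ xs} (x∉xs ∷ uniq) {zero}  {suc j} eq = contradiction eq (All.lookup x∉xs (∈-lookup j))
lookup-injective {xs = x ∷ xs} (x∉xs ∷ uniq) {suc i} {zero}  eq =
  contradiction (sym eq) (All.lookup x∉xs (∈-lookup i))
lookup-injective {xs = x ∷ xs} (x∉xs ∷ uniq) {suc i} {suc j} eq = cong suc (lookup-injective uniq eq)

unique⊆⇒length≤ : ∀ {A : Set} {xs ys : List A} → Unique ys → ys ⊆ xs → length ys ≤ length xs
unique⊆⇒length≤ {xs = xs} {ys} uniq ys⊆xs = injective⇒≤ position-injective
  where
  position : Fin (length ys) → Fin (length xs)
  position i = index (ys⊆xs (∈-lookup i))
  position-injective : ∀ {i j} → position i ≡ position j → i ≡ j
  position-injective {i} {j} eq = lookup-injective uniq (begin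
    List.lookup ys i            ≡⟨ lookup-index (ys⊆xs (∈-lookup i)) ⟩
    List.lookup xs (position i) ≡⟨ cong (List.lookup xs) eq ⟩
    List.lookup xs (position j) ≡⟨ lookup-index (ys⊆xs (∈-lookup j)) ⟨
    List.lookup ys j            ∎)
    where open ≡-Reasoning

module _ (G : Graph) (f : Labeling G) where

  private
    sums : List ℕ
    sums = tabulate {n = nv G} (vsum G f)

  numColors≤ : (vs : List ℕ) → (∀ x → vsum G f x ∈ vs) → numColors G f ≤ length vs
  numColors≤ vs covered = unique⊆⇒length≤ {xs = vs} (deduplicate-! sums) λ v∈ →
    case ∈-tabulate⁻ (∈-deduplicate⁻ _≟_ sums v∈) of λ where (x , refl) → covered x

  ≤numColors : (vs : List ℕ) → Unique vs → (∀ {v} → v ∈ vs → ∃ λ x → vsum G f x ≡ v) → length vs ≤ numColors G f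
  ≤numColors vs uniq realised = unique⊆⇒length≤ {xs = deduplicate _≟_ sums} uniq λ v∈ →
    case realised v∈ of λ where (x , refl) → ∈-deduplicate⁺ _≟_ (∈-tabulate⁺ x)

  two-sums-dichotomy : numColors G f ≤ 2 → ∀ {x y} → vsum G f x ≢ vsum G f y →
                       ∀ z → vsum G f z ≡ vsum G f x ⊎ vsum G f z ≡ vsum G f y
  two-sums-dichotomy ≤2 {x} {y} x≢y z with vsum G f z ≟ vsum G f x | vsum G f z ≟ vsum G f y
  ... | yes z≡x | _       = inj₁ z≡x
  ... | no _    | yes z≡y = inj₂ z≡y
  ... | no z≢x  | no z≢y  = contradiction (≤numColors (sx ∷ sy ∷ sz ∷ []) uniq realised) (≤⇒≯ ≤2)
    where
    sx sy sz : ℕ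
    sx = vsum G f x
    sy = vsum G f y
    sz = vsum G f z
    uniq : Unique (sx ∷ sy ∷ sz ∷ [])
    uniq = (x≢y All.∷ (z≢x ∘ sym) All.∷ All.[]) ∷ ((z≢y ∘ sym) All.∷ All.[]) ∷ All.[] ∷ []
    realised : ∀ {v} → v ∈ sx ∷ sy ∷ sz ∷ [] → ∃ λ x → vsum G f x ≡ v
    realised (here refl)                 = x , refl
    realised (there (here refl))         = y , refl
    realised (there (there (here refl))) = z , refl

-- The lower bound

bipartition : Fin 16 → Bool
bipartition = lookup (true ∷ false ∷ true ∷ false ∷ true ∷ false ∷ true ∷ false ∷
                      false ∷ true ∷ false ∷ true ∷ false ∷ true ∷ false ∷ true ∷ [])

bipartition-proper : IsProperTwoColouring C4-8-2 bipartition
bipartition-proper =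
  from-yes (all? λ e → ¬? (bipartition (proj₁ (ends C4-8-2 e)) Bool.≟ bipartition (proj₂ (ends C4-8-2 e))))

module _ (m : ℕ) (f : Labeling (copies (suc m) C4-8-2))
         (antimagic : IsLocalAntimagic (copies (suc m) C4-8-2) f) where

  private
    G : Graph
    G = copies (suc m) C4-8-2

    c₀ : Fin (suc m)
    c₀ = zero

    w : Fin 20 → ℕ
    w = label G f ∘ combine c₀

    s : Fin 16 → ℕ
    s = wsum C4-8-2 w

    s≡vsum : ∀ a → s a ≡ vsum G f (combine c₀ a)
    s≡vsum a = sym (vsum-copies (suc m) C4-8-2 f c₀ a)

    adjacent-distinct : ∀ e → s (proj₁ (ends C4-8-2 e)) ≢ s (proj₂ (ends C4-8-2 e))
    adjacent-distinct e eq = antimagic (combine c₀ e) (begin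
      vsum G f (proj₁ (ends G (combine c₀ e)))      ≡⟨ cong (vsum G f ∘ proj₁) (ends-copies (suc m) C4-8-2 c₀ e) ⟩
      vsum G f (combine c₀ (proj₁ (ends C4-8-2 e))) ≡⟨ s≡vsum (proj₁ (ends C4-8-2 e)) ⟨
      s (proj₁ (ends C4-8-2 e))                     ≡⟨ eq ⟩
      s (proj₂ (ends C4-8-2 e))                     ≡⟨ s≡vsum (proj₂ (ends C4-8-2 e)) ⟩
      vsum G f (combine c₀ (proj₂ (ends C4-8-2 e))) ≡⟨ cong (vsum G f ∘ proj₂) (ends-copies (suc m) C4-8-2 c₀ e) ⟨
      vsum G f (proj₂ (ends G (combine c₀ e)))      ∎)
      where open ≡-Reasoning

    module TwoSums (≤2 : numColors G f ≤ 2) where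

      p q : ℕ
      p = s (# 0)
      q = s (# 1)

      val : Bool → ℕ
      val b = if b then p else q

      s-dichotomy : ∀ a → s a ≡ p ⊎ s a ≡ q
      s-dichotomy a = Sum.map (via-vsum a (# 0)) (via-vsum a (# 1))
        (two-sums-dichotomy G f ≤2 {combine c₀ (# 0)} {combine c₀ (# 1)}
           (λ eq → adjacent-distinct (# 0) (via-vsum (# 0) (# 1) eq)) (combine c₀ a))
        where
        via-vsum : ∀ a b → vsum G f (combine c₀ a) ≡ vsum G f (combine c₀ b) → s a ≡ s b
        via-vsum a b eq = trans (s≡vsum a) (trans eq (sym (s≡vsum b)))

      across : ∀ e b → s (proj₁ (ends C4-8-2 e)) ≡ val b → s (proj₂ (ends C4-8-2 e)) ≡ val (not b)
      across e true  sa≡p = Sum.[ (λ sb≡p → contradiction (trans sa≡p (sym sb≡p)) (adjacent-distinct e)) , id ]′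
                              (s-dichotomy (proj₂ (ends C4-8-2 e)))
      across e false sa≡q = Sum.[ id , (λ sb≡q → contradiction (trans sa≡q (sym sb≡q)) (adjacent-distinct e)) ]′
                              (s-dichotomy (proj₂ (ends C4-8-2 e)))

      s≡val∘bipartition : ∀ a → s a ≡ val (bipartition a)
      s≡val∘bipartition =
        ∀-cons u₁ (∀-cons u₂ (∀-cons u₃ (∀-cons u₄ (∀-cons u₅ (∀-cons u₆ (∀-cons u₇ (∀-cons u₈
        (∀-cons v₁ (∀-cons v₂ (∀-cons v₃ (∀-cons v₄ (∀-cons v₅ (∀-cons v₆ (∀-cons v₇ (∀-cons v₈ λ ())))))))))))))))
        where
        -- uᵢ = # (i − 1) and vᵢ = # (7 + i); each step crosses one edge of a spanning tree.
        u₁ : s (# 0) ≡ val true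
        u₁ = refl
        u₂ : s (# 1) ≡ val false
        u₂ = refl
        u₃ : s (# 2) ≡ val true
        u₃ = across (# 1) false u₂
        u₄ : s (# 3) ≡ val false
        u₄ = across (# 2) true u₃
        u₅ : s (# 4) ≡ val true
        u₅ = across (# 3) false u₄
        u₆ : s (# 5) ≡ val false
        u₆ = across (# 4) true u₅
        u₇ : s (# 6) ≡ val true
        u₇ = across (# 5) false u₆
        u₈ : s (# 7) ≡ val false
        u₈ = across (# 6) true u₇
        v₂ : s (# 9) ≡ val true
        v₂ = across (# 16) false u₂
        v₃ : s (# 10) ≡ val false
        v₃ = across (# 9) true v₂
        v₄ : s (# 11) ≡ val true
        v₄ = across (# 10) false v₃
        v₅ : s (# 12) ≡ val false
        v₅ = across (# 11) true v₄
        v₆ : s (# 13) ≡ val true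
        v₆ = across (# 12) false v₅
        v₇ : s (# 14) ≡ val false
        v₇ = across (# 13) true v₆
        v₈ : s (# 15) ≡ val true
        v₈ = across (# 14) false v₇
        v₁ : s (# 8) ≡ val false
        v₁ = across (# 15) true v₈

      classSum-forced : ∀ χ → classSum C4-8-2 w χ ≡ ∑[ a < 16 ] (if χ a then val (bipartition a) else 0)
      classSum-forced χ = sum-cong-≗ λ a → cong (if χ a then_else 0) (s≡val∘bipartition a)

  numColors≰2 : numColors G f ≤ 2 → ⊥
  numColors≰2 ≤2 = adjacent-distinct (# 0) (*-cancelˡ-≡ p q 8 (begin
    8 * p                                 ≡⟨ classSum-forced bipartition ⟨
    classSum C4-8-2 w bipartition         ≡⟨ classSum≡total C4-8-2 {bipartition} bipartition-proper w ⟩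
    ∑[ e < 20 ] w e                       ≡⟨ classSum≡total C4-8-2 {not ∘ bipartition} not-proper w ⟨
    classSum C4-8-2 w (not ∘ bipartition) ≡⟨ classSum-forced (not ∘ bipartition) ⟩
    8 * q                                 ∎))
    where
    open ≡-Reasoning
    open TwoSums ≤2
    not-proper : IsProperTwoColouring C4-8-2 (not ∘ bipartition)
    not-proper e = bipartition-proper e ∘ not-injective

  3≤numColors : 3 ≤ numColors G f
  3≤numColors = ≰⇒> numColors≰2

-- The labelling

data Orientation : Set where
  ascending descending : Orientation

orient : ∀ {n} → Orientation → Permutation n n
orient ascending  = Perm.id
orient descending = Perm.reverse

data Layout : Set where
  alternating : Orientation → Layout
  consecutive : Orientation → Orientation → Layout

orientationOf : Orientation → Orientation → Fin 2 → Orientation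
orientationOf σ₀ σ₁ zero    = σ₀
orientationOf σ₀ σ₁ (suc _) = σ₁

arrange : ∀ {n} → Layout → (Fin 2 × Fin n) ↔ Fin (2 * n)
arrange {n} (alternating σ) = begin
  (Fin 2 × Fin n) ↔⟨ ×-comm (Fin 2) (Fin n) ⟩
  (Fin n × Fin 2) ↔⟨ orient σ ×-↔ ↔-id (Fin 2) ⟩
  (Fin n × Fin 2) ↔⟨ *↔× ⟨
  Fin (n * 2)     ↔⟨ Perm.cast-id (*-comm n 2) ⟩
  Fin (2 * n)     ∎
  where open EquationalReasoning {k = bijection}
arrange {n} (consecutive σ₀ σ₁) = begin
  (Fin 2 × Fin n) ↔⟨ Σ.congˡ (λ {d} → orient (orientationOf σ₀ σ₁ d)) ⟩
  (Fin 2 × Fin n) ↔⟨ *↔× ⟨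
  Fin (2 * n)     ∎
  where open EquationalReasoning {k = bijection}

toℕ-arrange-alternating : ∀ {n} σ (d : Fin 2) (c : Fin n) →
  toℕ (Inverse.to (arrange (alternating σ)) (d , c)) ≡ 2 * toℕ (orient σ ⟨$⟩ʳ c) + toℕ d
toℕ-arrange-alternating {n} σ d c = trans (toℕ-cast (*-comm n 2) _) (toℕ-combine (orient σ ⟨$⟩ʳ c) d)

toℕ-arrange-consecutive : ∀ {n} σ₀ σ₁ (d : Fin 2) (c : Fin n) →
  toℕ (Inverse.to (arrange (consecutive σ₀ σ₁)) (d , c)) ≡ n * toℕ d + toℕ (orient (orientationOf σ₀ σ₁ d) ⟨$⟩ʳ c)
toℕ-arrange-consecutive σ₀ σ₁ d c = toℕ-combine d _

-- Superblock K consists of the labels 2nK + 1, …, 2nK + 2n, which arrange (superblockLayout K)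
-- distributes over the pairs (d , c) of the edge slotEdge (K , d) and a copy c.

superblockLayout : Fin 10 → Layout
superblockLayout = lookup
  (alternating descending ∷ consecutive descending ascending ∷ alternating ascending ∷
   consecutive descending descending ∷ consecutive descending descending ∷ consecutive ascending ascending ∷
   consecutive ascending ascending ∷ alternating descending ∷ consecutive ascending descending ∷
   alternating ascending ∷ [])

slotEdge : Fin 10 × Fin 2 → Fin 20
slotEdge (K , d) = lookup (lookup table K) d
  where
  table : Vec (Vec (Fin 20) 2) 10
  table = (# 0 ∷ # 8 ∷ []) ∷ (# 19 ∷ # 18 ∷ []) ∷ (# 11 ∷ # 3 ∷ []) ∷ (# 2 ∷ # 6 ∷ []) ∷ (# 10 ∷ # 14 ∷ []) ∷
          (# 13 ∷ # 9 ∷ []) ∷ (# 5 ∷ # 1 ∷ []) ∷ (# 4 ∷ # 12 ∷ []) ∷ (# 16 ∷ # 17 ∷ []) ∷ (# 15 ∷ # 7 ∷ []) ∷ []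

edgeSlot : Fin 20 → Fin 10 × Fin 2
edgeSlot = lookup
  ((# 0 , # 0) ∷ (# 6 , # 1) ∷ (# 3 , # 0) ∷ (# 2 , # 1) ∷ (# 7 , # 0) ∷ (# 6 , # 0) ∷ (# 3 , # 1) ∷ (# 9 , # 1) ∷
   (# 0 , # 1) ∷ (# 5 , # 1) ∷ (# 4 , # 0) ∷ (# 2 , # 0) ∷ (# 7 , # 1) ∷ (# 5 , # 0) ∷ (# 4 , # 1) ∷ (# 9 , # 0) ∷
   (# 8 , # 0) ∷ (# 8 , # 1) ∷ (# 1 , # 1) ∷ (# 1 , # 0) ∷ [])

slots : Fin 20 ↔ (Fin 10 × Fin 2)
slots = mk↔ₛ′ edgeSlot slotEdge
  (λ (K , d) → from-yes (all? λ K → all? λ d → edgeSlot (slotEdge (K , d)) ≟ₛ (K , d)) K d)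
  (from-yes (all? λ e → slotEdge (edgeSlot e) FinP.≟ e))
  where
  _≟ₛ_ : DecidableEquality (Fin 10 × Fin 2)
  _≟ₛ_ = ≡-dec FinP._≟_ FinP._≟_

positions : ∀ n → (Fin n × Fin 20) ↔ Fin (n * 20)
positions n = begin
  (Fin n × Fin 20)           ↔⟨ ×-comm (Fin n) (Fin 20) ⟩
  (Fin 20 × Fin n)           ↔⟨ slots ×-↔ ↔-id (Fin n) ⟩
  ((Fin 10 × Fin 2) × Fin n) ↔⟨ ×-assoc _ (Fin 10) (Fin 2) (Fin n) ⟩
  (Fin 10 × (Fin 2 × Fin n)) ↔⟨ Σ.congˡ (λ {K} → arrange (superblockLayout K)) ⟩
  (Fin 10 × Fin (2 * n))     ↔⟨ *↔× ⟨
  Fin (10 * (2 * n))         ↔⟨ Perm.cast-id (size n) ⟩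
  Fin (n * 20)               ∎
  where
  open EquationalReasoning {k = bijection}
  size : ∀ n → 10 * (2 * n) ≡ n * 20
  size = solve-∀

labelling : ∀ n → Labeling (copies n C4-8-2)
labelling n = positions n ↔-∘ *↔×

toℕ-labelling : ∀ {n} (c : Fin n) e → let (K , d) = edgeSlot e in
  toℕ (Inverse.to (labelling n) (combine c e)) ≡
  2 * n * toℕ K + toℕ (Inverse.to (arrange (superblockLayout K)) (d , c))
toℕ-labelling {n} c e = begin
  toℕ (Inverse.to (labelling n) (combine c e)) ≡⟨ cong (toℕ ∘ Inverse.to (positions n)) (remQuot-combine c e) ⟩
  toℕ (Inverse.to (positions n) (c , e))       ≡⟨ toℕ-cast _ (combine K μ) ⟩
  toℕ (combine K μ)                            ≡⟨ toℕ-combine K μ ⟩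
  2 * n * toℕ K + toℕ μ                        ∎
  where
  open ≡-Reasoning
  K : Fin 10
  K = proj₁ (edgeSlot e)
  μ : Fin (2 * n)
  μ = Inverse.to (arrange (superblockLayout K)) (proj₂ (edgeSlot e) , c)

-- Affine forms in the copy coordinates

-- (a , b , c) stands for a t + b o + c, where copy c of n has t = c and o = n − 1 − c;
-- thus 𝕟 = t + o + 1 is the number of copies.

Affine : Set
Affine = ℕ × ℕ × ℕ

⟦_⟧ : Affine → ℕ → ℕ → ℕ
⟦ a , b , c ⟧ t o = a * t + b * o + c

infixl 6 _⊕_
infixl 7 _⊛_

_⊕_ : Affine → Affine → Affine
(a , b , c) ⊕ (a′ , b′ , c′) = a + a′ , b + b′ , c + c′

_⊛_ : ℕ → Affine → Affine
k ⊛ (a , b , c) = k * a , k * b , k * c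

𝟘 𝟙 𝕟 : Affine
𝟘 = 0 , 0 , 0
𝟙 = 0 , 0 , 1
𝕟 = 1 , 1 , 1

⟦⊕⟧ : ∀ A B t o → ⟦ A ⊕ B ⟧ t o ≡ ⟦ A ⟧ t o + ⟦ B ⟧ t o
⟦⊕⟧ (a , b , c) (a′ , b′ , c′) = distrib a b c a′ b′ c′
  where
  distrib : ∀ a b c a′ b′ c′ t o →
            (a + a′) * t + (b + b′) * o + (c + c′) ≡ (a * t + b * o + c) + (a′ * t + b′ * o + c′)
  distrib = solve-∀

⟦⊛⟧ : ∀ k A t o → ⟦ k ⊛ A ⟧ t o ≡ k * ⟦ A ⟧ t o
⟦⊛⟧ k (a , b , c) = distrib k a b c
  where
  distrib : ∀ k a b c t o → k * a * t + k * b * o + k * c ≡ k * (a * t + b * o + c)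
  distrib = solve-∀

⟦𝕟⟧ : ∀ t o → ⟦ 𝕟 ⟧ t o ≡ suc (t + o)
⟦𝕟⟧ = simplify
  where
  simplify : ∀ t o → 1 * t + 1 * o + 1 ≡ suc (t + o)
  simplify = solve-∀

Σᵃ : ∀ {k} → (Fin k → Affine) → Affine
Σᵃ {zero}  ψ = 𝟘
Σᵃ {suc k} ψ = ψ zero ⊕ Σᵃ (ψ ∘ suc)

sum-⟦⟧ : ∀ {k} (ψ : Fin k → Affine) t o → ∑[ i < k ] ⟦ ψ i ⟧ t o ≡ ⟦ Σᵃ ψ ⟧ t o
sum-⟦⟧ {zero}  ψ t o = refl
sum-⟦⟧ {suc k} ψ t o =
  trans (cong (⟦ ψ zero ⟧ t o +_) (sum-⟦⟧ (ψ ∘ suc) t o)) (sym (⟦⊕⟧ (ψ zero) (Σᵃ (ψ ∘ suc)) t o))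

wsumᵃ : (G : Graph) → (Fin (ne G) → Affine) → Fin (nv G) → Affine
wsumᵃ G φ x = Σᵃ (λ e → if incident G x e then φ e else 𝟘)

wsum-⟦⟧ : ∀ G (φ : Fin (ne G) → Affine) x t o → wsum G (λ e → ⟦ φ e ⟧ t o) x ≡ ⟦ wsumᵃ G φ x ⟧ t o
wsum-⟦⟧ G φ x t o =
  trans (sum-cong-≗ (λ e → if-⟦⟧ (incident G x e) (φ e))) (sum-⟦⟧ (λ e → if incident G x e then φ e else 𝟘) t o)
  where
  if-⟦⟧ : ∀ b A → (if b then ⟦ A ⟧ t o else 0) ≡ ⟦ if b then A else 𝟘 ⟧ t o
  if-⟦⟧ true  A = refl
  if-⟦⟧ false A = refl

orientAffine : Orientation → Affine
orientAffine ascending  = 1 , 0 , 0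
orientAffine descending = 0 , 1 , 0

layoutAffine : Layout → Fin 2 → Affine
layoutAffine (alternating σ)     d = 2 ⊛ orientAffine σ ⊕ toℕ d ⊛ 𝟙
layoutAffine (consecutive σ₀ σ₁) d = toℕ d ⊛ 𝕟 ⊕ orientAffine (orientationOf σ₀ σ₁ d)

edgeAffine : Fin 20 → Affine
edgeAffine e = 𝟙 ⊕ toℕ K ⊛ (2 ⊛ 𝕟) ⊕ layoutAffine (superblockLayout K) d
  where
  K : Fin 10
  K = proj₁ (edgeSlot e)
  d : Fin 2
  d = proj₂ (edgeSlot e)

module _ {n} (c : Fin n) where

  private
    t o : ℕ
    t = toℕ c
    o = toℕ (opposite c)

  ⟦𝕟⟧-copy : ⟦ 𝕟 ⟧ t o ≡ n
  ⟦𝕟⟧-copy = begin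
    ⟦ 𝕟 ⟧ t o           ≡⟨ ⟦𝕟⟧ t o ⟩
    suc t + o           ≡⟨ cong (suc t +_) (opposite-prop c) ⟩
    suc t + (n ∸ suc t) ≡⟨ m+[n∸m]≡n (toℕ<n c) ⟩
    n                   ∎
    where open ≡-Reasoning

  orient-⟦⟧ : ∀ σ → ⟦ orientAffine σ ⟧ t o ≡ toℕ (orient σ ⟨$⟩ʳ c)
  orient-⟦⟧ ascending  = simplify t o
    where
    simplify : ∀ t o → 1 * t + 0 * o + 0 ≡ t
    simplify = solve-∀
  orient-⟦⟧ descending = simplify t o
    where
    simplify : ∀ t o → 0 * t + 1 * o + 0 ≡ o
    simplify = solve-∀

  layout-⟦⟧ : ∀ ℓ d → ⟦ layoutAffine ℓ d ⟧ t o ≡ toℕ (Inverse.to (arrange ℓ) (d , c))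
  layout-⟦⟧ (alternating σ) d = begin
    ⟦ 2 ⊛ orientAffine σ ⊕ toℕ d ⊛ 𝟙 ⟧ t o            ≡⟨ ⟦⊕⟧ (2 ⊛ orientAffine σ) (toℕ d ⊛ 𝟙) t o ⟩
    ⟦ 2 ⊛ orientAffine σ ⟧ t o + ⟦ toℕ d ⊛ 𝟙 ⟧ t o    ≡⟨ cong₂ _+_ (⟦⊛⟧ 2 (orientAffine σ) t o) (⟦⊛⟧ (toℕ d) 𝟙 t o) ⟩
    2 * ⟦ orientAffine σ ⟧ t o + toℕ d * 1             ≡⟨ cong₂ (λ x y → 2 * x + y) (orient-⟦⟧ σ) (*-identityʳ (toℕ d)) ⟩
    2 * toℕ (orient σ ⟨$⟩ʳ c) + toℕ d                  ≡⟨ toℕ-arrange-alternating σ d c ⟨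
    toℕ (Inverse.to (arrange (alternating σ)) (d , c)) ∎
    where open ≡-Reasoning
  layout-⟦⟧ (consecutive σ₀ σ₁) d = begin
    ⟦ toℕ d ⊛ 𝕟 ⊕ orientAffine σ ⟧ t o                     ≡⟨ ⟦⊕⟧ (toℕ d ⊛ 𝕟) (orientAffine σ) t o ⟩
    ⟦ toℕ d ⊛ 𝕟 ⟧ t o + ⟦ orientAffine σ ⟧ t o              ≡⟨ cong₂ _+_ (⟦⊛⟧ (toℕ d) 𝕟 t o) (orient-⟦⟧ σ) ⟩
    toℕ d * ⟦ 𝕟 ⟧ t o + r                                   ≡⟨ cong (λ k → toℕ d * k + r) ⟦𝕟⟧-copy ⟩
    toℕ d * n + r                                           ≡⟨ cong (_+ r) (*-comm (toℕ d) n) ⟩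
    n * toℕ d + r                                           ≡⟨ toℕ-arrange-consecutive σ₀ σ₁ d c ⟨
    toℕ (Inverse.to (arrange (consecutive σ₀ σ₁)) (d , c)) ∎
    where
    open ≡-Reasoning
    σ : Orientation
    σ = orientationOf σ₀ σ₁ d
    r : ℕ
    r = toℕ (orient σ ⟨$⟩ʳ c)

  label-⟦⟧ : ∀ e → label (copies n C4-8-2) (labelling n) (combine c e) ≡ ⟦ edgeAffine e ⟧ t o
  label-⟦⟧ e = begin
    suc (toℕ (Inverse.to (labelling n) (combine c e)))       ≡⟨ cong suc (toℕ-labelling c e) ⟩
    suc (2 * n * toℕ K + toℕ μ)                               ≡⟨ cong suc (cong₂ _+_ superblock (layout-⟦⟧ ℓ d)) ⟨
    suc (⟦ toℕ K ⊛ (2 ⊛ 𝕟) ⟧ t o + ⟦ layoutAffine ℓ d ⟧ t o)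
      ≡⟨ cong (_+ ⟦ layoutAffine ℓ d ⟧ t o) (⟦⊕⟧ 𝟙 (toℕ K ⊛ (2 ⊛ 𝕟)) t o) ⟨
    ⟦ 𝟙 ⊕ toℕ K ⊛ (2 ⊛ 𝕟) ⟧ t o + ⟦ layoutAffine ℓ d ⟧ t o
      ≡⟨ ⟦⊕⟧ (𝟙 ⊕ toℕ K ⊛ (2 ⊛ 𝕟)) (layoutAffine ℓ d) t o ⟨
    ⟦ edgeAffine e ⟧ t o                                      ∎
    where
    open ≡-Reasoning
    K : Fin 10
    K = proj₁ (edgeSlot e)
    d : Fin 2
    d = proj₂ (edgeSlot e)
    ℓ : Layout
    ℓ = superblockLayout K
    μ : Fin (2 * n)
    μ = Inverse.to (arrange ℓ) (d , c)
    superblock : ⟦ toℕ K ⊛ (2 ⊛ 𝕟) ⟧ t o ≡ 2 * n * toℕ K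
    superblock = begin
      ⟦ toℕ K ⊛ (2 ⊛ 𝕟) ⟧ t o ≡⟨ ⟦⊛⟧ (toℕ K) (2 ⊛ 𝕟) t o ⟩
      toℕ K * ⟦ 2 ⊛ 𝕟 ⟧ t o   ≡⟨ cong (toℕ K *_) (⟦⊛⟧ 2 𝕟 t o) ⟩
      toℕ K * (2 * ⟦ 𝕟 ⟧ t o) ≡⟨ cong (λ k → toℕ K * (2 * k)) ⟦𝕟⟧-copy ⟩
      toℕ K * (2 * n)         ≡⟨ *-comm (toℕ K) (2 * n) ⟩
      2 * n * toℕ K           ∎

Colour : Set
Colour = Fin 3

pattern X = zero
pattern Z = suc zero
pattern Y = suc (suc zero)

-- The vertex sums 20n + 1, 29n + 2 and 31n + 1, written in terms of m = n − 1.

slope intercept : Colour → ℕ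
slope X = 20
slope Z = 29
slope Y = 31
intercept X = 21
intercept Z = 31
intercept Y = 32

colourValue : Colour → ℕ → ℕ
colourValue κ m = slope κ * m + intercept κ

balanced : Colour → Affine
balanced κ = slope κ , slope κ , intercept κ

⟦balanced⟧ : ∀ κ t o → ⟦ balanced κ ⟧ t o ≡ colourValue κ (t + o)
⟦balanced⟧ κ t o = cong (_+ intercept κ) (sym (*-distribˡ-+ (slope κ) t o))

affine-< : ∀ m {a b c d} → a ≤ b → c < d → a * m + c < b * m + d
affine-< m a≤b c<d = +-mono-≤-< (*-monoˡ-≤ m a≤b) c<d

X<Z : ∀ m → colourValue X m < colourValue Z m
X<Z m = affine-< m (from-yes (20 ≤? 29)) (from-yes (21 <? 31))

Z<Y : ∀ m → colourValue Z m < colourValue Y m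
Z<Y m = affine-< m (from-yes (29 ≤? 31)) (from-yes (31 <? 32))

X<Y : ∀ m → colourValue X m < colourValue Y m
X<Y m = affine-< m (from-yes (20 ≤? 31)) (from-yes (21 <? 32))

colourValue-injective : ∀ m {κ κ′} → colourValue κ m ≡ colourValue κ′ m → κ ≡ κ′
colourValue-injective m {X} {X} _  = refl
colourValue-injective m {Z} {Z} _  = refl
colourValue-injective m {Y} {Y} _  = refl
colourValue-injective m {X} {Z} eq = contradiction eq (<⇒≢ (X<Z m))
colourValue-injective m {Z} {X} eq = contradiction (sym eq) (<⇒≢ (X<Z m))
colourValue-injective m {X} {Y} eq = contradiction eq (<⇒≢ (X<Y m))
colourValue-injective m {Y} {X} eq = contradiction (sym eq) (<⇒≢ (X<Y m))
colourValue-injective m {Z} {Y} eq = contradiction eq (<⇒≢ (Z<Y m))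
colourValue-injective m {Y} {Z} eq = contradiction (sym eq) (<⇒≢ (Z<Y m))

colour : Fin 16 → Colour
colour = lookup (X ∷ Y ∷ X ∷ Z ∷ X ∷ Y ∷ X ∷ Z ∷ X ∷ Z ∷ X ∷ Y ∷ X ∷ Z ∷ X ∷ Y ∷ [])

colour-proper : ∀ e → colour (proj₁ (ends C4-8-2 e)) ≢ colour (proj₂ (ends C4-8-2 e))
colour-proper = from-yes (all? λ e → ¬? (colour (proj₁ (ends C4-8-2 e)) FinP.≟ colour (proj₂ (ends C4-8-2 e))))

colour-witness : ∀ κ → ∃ λ a → colour a ≡ κ
colour-witness X = # 0 , refl
colour-witness Z = # 3 , refl
colour-witness Y = # 1 , refl

vertex-balanced : ∀ a → wsumᵃ C4-8-2 edgeAffine a ≡ balanced (colour a)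
vertex-balanced = from-yes (all? λ a → wsumᵃ C4-8-2 edgeAffine a ≟ᵃ balanced (colour a))
  where
  _≟ᵃ_ : DecidableEquality Affine
  _≟ᵃ_ = ≡-dec _≟_ (≡-dec _≟_ _≟_)

module _ (m : ℕ) where

  private
    n : ℕ
    n = suc m

    G : Graph
    G = copies n C4-8-2

    F : Labeling G
    F = labelling n

    c₀ : Fin n
    c₀ = zero

  vsum-labelling : ∀ (c : Fin n) a → vsum G F (combine c a) ≡ colourValue (colour a) m
  vsum-labelling c a = begin
    vsum G F (combine c a)                     ≡⟨ vsum-copies n C4-8-2 F c a ⟩
    wsum C4-8-2 (label G F ∘ combine c) a      ≡⟨ wsum-cong C4-8-2 (label-⟦⟧ c) a ⟩
    wsum C4-8-2 (λ e → ⟦ edgeAffine e ⟧ t o) a ≡⟨ wsum-⟦⟧ C4-8-2 edgeAffine a t o ⟩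
    ⟦ wsumᵃ C4-8-2 edgeAffine a ⟧ t o          ≡⟨ cong (λ A → ⟦ A ⟧ t o) (vertex-balanced a) ⟩
    ⟦ balanced (colour a) ⟧ t o                ≡⟨ ⟦balanced⟧ (colour a) t o ⟩
    colourValue (colour a) (t + o)             ≡⟨ cong (colourValue (colour a)) t+o≡m ⟩
    colourValue (colour a) m                   ∎
    where
    open ≡-Reasoning
    t o : ℕ
    t = toℕ c
    o = toℕ (opposite c)
    t+o≡m : t + o ≡ m
    t+o≡m = suc-injective (trans (sym (⟦𝕟⟧ t o)) (⟦𝕟⟧-copy c))

  labelling-antimagic : IsLocalAntimagic G F
  labelling-antimagic = ∀-combine λ c e eq → colour-proper e (colourValue-injective m (begin
    colourValue (colour (proj₁ (ends C4-8-2 e))) m ≡⟨ vsum-labelling c (proj₁ (ends C4-8-2 e)) ⟨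
    vsum G F (combine c (proj₁ (ends C4-8-2 e)))   ≡⟨ cong (vsum G F ∘ proj₁) (ends-copies n C4-8-2 c e) ⟨
    vsum G F (proj₁ (ends G (combine c e)))        ≡⟨ eq ⟩
    vsum G F (proj₂ (ends G (combine c e)))        ≡⟨ cong (vsum G F ∘ proj₂) (ends-copies n C4-8-2 c e) ⟩
    vsum G F (combine c (proj₂ (ends C4-8-2 e)))   ≡⟨ vsum-labelling c (proj₂ (ends C4-8-2 e)) ⟩
    colourValue (colour (proj₂ (ends C4-8-2 e))) m ∎))
    where open ≡-Reasoning

  labelling-numColors : numColors G F ≡ 3
  labelling-numColors = ≤-antisym (numColors≤ G F palette covered) (≤numColors G F palette unique realised)
    where
    palette : List ℕ
    palette = List.map (λ κ → colourValue κ m) (allFin 3)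
    covered : ∀ x → vsum G F x ∈ palette
    covered = ∀-combine λ c a →
      subst (_∈ palette) (sym (vsum-labelling c a)) (∈-map⁺ (λ κ → colourValue κ m) (∈-allFin (colour a)))
    unique : Unique palette
    unique = map⁺ {f = λ κ → colourValue κ m} (colourValue-injective m) (allFin⁺ 3)
    realised : ∀ {v} → v ∈ palette → ∃ λ x → vsum G F x ≡ v
    realised v∈ =
      let κ , _ , v≡κ = ∈-map⁻ (λ κ → colourValue κ m) {xs = allFin 3} v∈
          a , colour-a≡κ = colour-witness κ
      in combine c₀ a , trans (vsum-labelling c₀ a) (trans (cong (λ κ → colourValue κ m) colour-a≡κ) (sym v≡κ))

theorem3p1 : ∀ (n : ℕ) → n ≥ 1 → ChiLa≡ (copies n C4-8-2) 3
theorem3p1 zero    ()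
theorem3p1 (suc m) _ = (labelling (suc m) , labelling-antimagic m , labelling-numColors m) , 3≤numColors m
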